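{- Let $\lambda \ge 2$ be an integer and let $D$ be a two-way $(2,\lambda)$-liking digraph of order $n$. Then $D$ is $k$-diregular for a positive integer $k$ satisfying \[(n-1)\lambda = k(k-1).\]
   Context: All digraphs are finite, with no loops and no multiple arcs. For positive integers $t$ and $\lambda$, a digraph is a two-way $(t,\lambda)$-liking digraph if every set of $t$ distinct vertices has exactly $\lambda$ common out-neighbors and exactly $\lambda$ common in-neighbors. A digraph is $k$-diregular (for a positive integer $k$) if every vertex has outdegree $k$ and indegree $k$. -}

module Defs where

open import Data.Nat using (ℕ)
open import Data.Bool using (Bool; false)
open import Data.Fin using (Fin)
open import Data.Fin.Subset using (Subset; _∩_; ∣_∣)
open import Data.Vec using (tabulate)
open import Data.Product using (_×_)
open import Relation.Binary.PropositionalEquality using (_≡_; _≢_)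

-- Multiple arcs are impossible by construction; loops are excluded.
record Digraph (n : ℕ) : Set where
  field
    arc      : Fin n → Fin n → Bool
    loopless : ∀ v → arc v v ≡ false

open Digraph public

module _ {n : ℕ} (D : Digraph n) where

  outN : Fin n → Subset n
  outN u = tabulate (λ w → arc D u w)

  inN : Fin n → Subset n
  inN u = tabulate (λ w → arc D w u)

  outdeg : Fin n → ℕ
  outdeg u = ∣ outN u ∣

  indeg : Fin n → ℕ
  indeg u = ∣ inN u ∣

  TwoWayLiking2 : ℕ → Set
  TwoWayLiking2 λ′ = ∀ u v → u ≢ v →
    (∣ outN u ∩ outN v ∣ ≡ λ′) × (∣ inN u ∩ inN v ∣ ≡ λ′)

  Diregular : ℕ → Set
  Diregular k = ∀ v → (outdeg v ≡ k) × (indeg v ≡ k)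

{-# OPTIONS --safe #-}
-- Let A be the 0/1 adjacency matrix of D, with row sums r (outdegrees) and
-- column sums c (indegrees).  Two-way liking says that A Aᵀ and Aᵀ A equal λ
-- off the diagonal, with diagonals r and c.  Computing the (u, w) entry of
-- A Aᵀ A in both ways gives λ c_w + r_u a_uw = λ r_u + c_w a_uw, that is
-- (λ − a_uw)(c_w − r_u) = 0; since a_uw ≤ 1 < λ, every indegree equals every
-- outdegree, say k.  Summing row u of A Aᵀ then gives k² = (n − 1)λ + k.
module Submission where

open import Defs
open import Data.Nat using (ℕ; zero; suc; _+_; _*_; _∸_; _≤_; _<_; z≤n; s≤s)
open import Data.Nat.Properties
  using (+-*-semiring; *-comm; *-assoc; +-cancelʳ-≡; *-cancelˡ-≡; *-distribˡ-∸;
         *-identityˡ; *-identityʳ; m+n∸n≡m; ≤-trans; m≤n⇒∃[o]m+o≡n; *-mono-≤)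
open import Data.Nat.Solver using (module +-*-Solver)
open import Data.Bool using (Bool; true; false; _∧_)
open import Data.Fin using (Fin; punchIn)
open import Data.Fin.Properties using (punchInᵢ≢i)
open import Data.Fin.Subset using (_∩_; ∣_∣)
open import Data.Fin.Subset.Properties using (∩-idem)
open import Data.Vec using (tabulate; _∷_)
open import Data.Product using (Σ; _×_; _,_; proj₁; proj₂)
open import Relation.Binary.PropositionalEquality
open import Function using (_∘_)
open import Algebra.Properties.Semiring.Sum +-*-semiring
  using (sum; sum-syntax; sum-cong-≗; sum-remove; ∑-comm; *-distribˡ-sum; *-distribʳ-sum)

open +-*-Solver using (solve; con; _:+_; _:*_; _:=_)
open ≡-Reasoning

toℕ : Bool → ℕ
toℕ true  = 1
toℕ false = 0

toℕ-∧ : ∀ a b → toℕ (a ∧ b) ≡ toℕ a * toℕ b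
toℕ-∧ true  b = sym (*-identityˡ (toℕ b))
toℕ-∧ false b = refl

toℕ<2 : ∀ b → toℕ b < 2
toℕ<2 true  = s≤s (s≤s z≤n)
toℕ<2 false = s≤s z≤n

∑-const : ∀ n c → ∑[ i < n ] c ≡ n * c
∑-const zero    c = refl
∑-const (suc n) c = cong (c +_) (∑-const n c)

∑-except : ∀ {n} {f g : Fin n → ℕ} i → (∀ j → j ≢ i → f j ≡ g j) →
           sum f + g i ≡ sum g + f i
∑-except {suc n} {f} {g} i f≡g = begin
  sum f + g i                                ≡⟨ cong (_+ g i) (sum-remove f) ⟩
  f i + sum (λ j → f (punch j)) + g i        ≡⟨ cong (λ s → f i + s + g i) (sum-cong-≗ away) ⟩
  f i + sum (λ j → g (punch j)) + g i        ≡⟨ solve 3 (λ a s b → a :+ s :+ b := b :+ s :+ a)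
                                                       refl (f i) _ (g i) ⟩
  g i + sum (λ j → g (punch j)) + f i        ≡⟨ cong (_+ f i) (sum-remove g) ⟨
  sum g + f i                                ∎
  where
  punch : Fin n → Fin (suc n)
  punch = punchIn i
  away : ∀ j → f (punch j) ≡ g (punch j)
  away j = f≡g (punch j) (punchInᵢ≢i i j)

∑-weighted-except : ∀ {n} {f b : Fin n → ℕ} {c} i → (∀ j → j ≢ i → f j ≡ c) →
                    ∑[ j < n ] (f j * b j) + c * b i ≡ c * sum b + f i * b i
∑-weighted-except {f = f} {b} {c} i f≡c = begin
  ∑[ j < _ ] (f j * b j) + c * b i  ≡⟨ ∑-except i (λ j j≢i → cong (_* b j) (f≡c j j≢i)) ⟩
  ∑[ j < _ ] (c * b j) + f i * b i  ≡⟨ cong (_+ f i * b i) (*-distribˡ-sum c b) ⟨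
  c * sum b + f i * b i             ∎

∣tabulate∣ : ∀ {n} (f : Fin n → Bool) → ∣ tabulate f ∣ ≡ ∑[ i < n ] toℕ (f i)
∣tabulate∣ {zero}  f = refl
∣tabulate∣ {suc n} f with f Fin.zero
... | true  = cong suc (∣tabulate∣ (λ i → f (Fin.suc i)))
... | false = ∣tabulate∣ (λ i → f (Fin.suc i))

tabulate-∩ : ∀ {n} (f g : Fin n → Bool) → tabulate f ∩ tabulate g ≡ tabulate (λ i → f i ∧ g i)
tabulate-∩ {zero}  f g = refl
tabulate-∩ {suc n} f g =
  cong (f Fin.zero ∧ g Fin.zero ∷_) (tabulate-∩ (λ i → f (Fin.suc i)) (λ i → g (Fin.suc i)))

∣tabulate∩tabulate∣ : ∀ {n} (f g : Fin n → Bool) →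
                      ∣ tabulate f ∩ tabulate g ∣ ≡ ∑[ i < n ] (toℕ (f i) * toℕ (g i))
∣tabulate∩tabulate∣ f g = begin
  ∣ tabulate f ∩ tabulate g ∣              ≡⟨ cong ∣_∣ (tabulate-∩ f g) ⟩
  ∣ tabulate (λ i → f i ∧ g i) ∣           ≡⟨ ∣tabulate∣ (λ i → f i ∧ g i) ⟩
  ∑[ i < _ ] toℕ (f i ∧ g i)               ≡⟨ sum-cong-≗ (λ i → toℕ-∧ (f i) (g i)) ⟩
  ∑[ i < _ ] (toℕ (f i) * toℕ (g i))       ∎

cancel-by-difference : ∀ {a c x y} → a < c → c * x + y * a ≡ c * y + x * a → x ≡ y
cancel-by-difference {a} {x = x} {y} a<c eq with m≤n⇒∃[o]m+o≡n a<c
... | d , refl = *-cancelˡ-≡ x y (suc d) (+-cancelʳ-≡ (a * x + a * y) (suc d * x) (suc d * y) (begin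
  suc d * x + (a * x + a * y)
    ≡⟨ solve 4 (λ a d x y → (con 1 :+ d) :* x :+ (a :* x :+ a :* y)
                          := (con 1 :+ (a :+ d)) :* x :+ y :* a) refl a d x y ⟩
  suc (a + d) * x + y * a
    ≡⟨ eq ⟩
  suc (a + d) * y + x * a
    ≡⟨ solve 4 (λ a d x y → (con 1 :+ (a :+ d)) :* y :+ x :* a
                          := (con 1 :+ d) :* y :+ (a :* x :+ a :* y)) refl a d x y ⟩
  suc d * y + (a * x + a * y)
    ∎))

k*k+c≡[1+m]*c+k⇒k*[k∸1]≡m*c : ∀ k m c → k * k + c ≡ suc m * c + k → k * (k ∸ 1) ≡ m * c
k*k+c≡[1+m]*c+k⇒k*[k∸1]≡m*c k m c eq = begin
  k * (k ∸ 1)       ≡⟨ *-distribˡ-∸ k k 1 ⟩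
  k * k ∸ k * 1     ≡⟨ cong₂ _∸_ k*k≡m*c+k (*-identityʳ k) ⟩
  m * c + k ∸ k     ≡⟨ m+n∸n≡m (m * c) k ⟩
  m * c             ∎
  where
  k*k≡m*c+k : k * k ≡ m * c + k
  k*k≡m*c+k = +-cancelʳ-≡ c (k * k) (m * c + k) (trans eq
    (solve 3 (λ m c k → (con 1 :+ m) :* c :+ k := m :* c :+ k :+ c) refl m c k))

1≤m*n⇒1≤m : ∀ m {n} → 1 ≤ m * n → 1 ≤ m
1≤m*n⇒1≤m (suc m) _ = s≤s z≤n

module _ {n : ℕ} (D : Digraph n) where

  adj : Fin n → Fin n → ℕ
  adj u v = toℕ (arc D u v)

  commonOut commonIn : Fin n → Fin n → ℕ
  commonOut u v = ∣ outN D u ∩ outN D v ∣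
  commonIn  u v = ∣ inN D u ∩ inN D v ∣

  outdeg≡∑adj : ∀ u → outdeg D u ≡ ∑[ x < n ] adj u x
  outdeg≡∑adj u = ∣tabulate∣ (arc D u)

  indeg≡∑adj : ∀ w → indeg D w ≡ ∑[ v < n ] adj v w
  indeg≡∑adj w = ∣tabulate∣ (λ v → arc D v w)

  commonOut≡∑adj*adj : ∀ u v → commonOut u v ≡ ∑[ x < n ] (adj u x * adj v x)
  commonOut≡∑adj*adj u v = ∣tabulate∩tabulate∣ (arc D u) (arc D v)

  commonIn≡∑adj*adj : ∀ x w → commonIn x w ≡ ∑[ v < n ] (adj v x * adj v w)
  commonIn≡∑adj*adj x w = ∣tabulate∩tabulate∣ (λ v → arc D v x) (λ v → arc D v w)

  commonOut-diag : ∀ u → commonOut u u ≡ outdeg D u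
  commonOut-diag u = cong ∣_∣ (∩-idem (outN D u))

  commonIn-diag : ∀ w → commonIn w w ≡ indeg D w
  commonIn-diag w = cong ∣_∣ (∩-idem (inN D w))

  ∑commonOut*adj≡∑adj*commonIn : ∀ u w →
    ∑[ v < n ] (commonOut u v * adj v w) ≡ ∑[ x < n ] (adj u x * commonIn x w)
  ∑commonOut*adj≡∑adj*commonIn u w = begin
    ∑[ v < n ] (commonOut u v * adj v w)
      ≡⟨ sum-cong-≗ (λ v → cong (_* adj v w) (commonOut≡∑adj*adj u v)) ⟩
    ∑[ v < n ] (∑[ x < n ] (adj u x * adj v x) * adj v w)
      ≡⟨ sum-cong-≗ (λ v → *-distribʳ-sum (adj v w) (λ x → adj u x * adj v x)) ⟩
    ∑[ v < n ] ∑[ x < n ] (adj u x * adj v x * adj v w)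
      ≡⟨ ∑-comm (λ v x → adj u x * adj v x * adj v w) ⟩
    ∑[ x < n ] ∑[ v < n ] (adj u x * adj v x * adj v w)
      ≡⟨ sum-cong-≗ (λ x → sum-cong-≗ (λ v → *-assoc (adj u x) (adj v x) (adj v w))) ⟩
    ∑[ x < n ] ∑[ v < n ] (adj u x * (adj v x * adj v w))
      ≡⟨ sum-cong-≗ (λ x → *-distribˡ-sum (adj u x) (λ v → adj v x * adj v w)) ⟨
    ∑[ x < n ] (adj u x * ∑[ v < n ] (adj v x * adj v w))
      ≡⟨ sum-cong-≗ (λ x → cong (adj u x *_) (commonIn≡∑adj*adj x w)) ⟨
    ∑[ x < n ] (adj u x * commonIn x w)
      ∎

  ∑commonOut≡∑adj*indeg : ∀ u → ∑[ v < n ] commonOut u v ≡ ∑[ x < n ] (adj u x * indeg D x)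
  ∑commonOut≡∑adj*indeg u = begin
    ∑[ v < n ] commonOut u v
      ≡⟨ sum-cong-≗ (commonOut≡∑adj*adj u) ⟩
    ∑[ v < n ] ∑[ x < n ] (adj u x * adj v x)
      ≡⟨ ∑-comm (λ v x → adj u x * adj v x) ⟩
    ∑[ x < n ] ∑[ v < n ] (adj u x * adj v x)
      ≡⟨ sum-cong-≗ (λ x → *-distribˡ-sum (adj u x) (λ v → adj v x)) ⟨
    ∑[ x < n ] (adj u x * ∑[ v < n ] adj v x)
      ≡⟨ sum-cong-≗ (λ x → cong (adj u x *_) (indeg≡∑adj x)) ⟨
    ∑[ x < n ] (adj u x * indeg D x)
      ∎

  equal-degrees⇒diregular : (∀ u w → indeg D w ≡ outdeg D u) → ∀ v₀ → Diregular D (outdeg D v₀)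
  equal-degrees⇒diregular in≡out v₀ v = trans (sym (in≡out v v₀)) (in≡out v₀ v₀) , in≡out v₀ v

module _ {n : ℕ} (D : Digraph n) {λ′ : ℕ} (liking : TwoWayLiking2 D λ′) where

  commonOut-liking : ∀ u v → v ≢ u → commonOut D u v ≡ λ′
  commonOut-liking u v v≢u = proj₁ (liking u v (v≢u ∘ sym))

  commonIn-liking : ∀ x w → x ≢ w → commonIn D x w ≡ λ′
  commonIn-liking x w x≢w = proj₂ (liking x w x≢w)

  degree-balance : ∀ u w →
    λ′ * indeg D w + outdeg D u * adj D u w ≡ λ′ * outdeg D u + indeg D w * adj D u w
  degree-balance u w = begin
    λ′ * indeg D w + outdeg D u * adj D u w
      ≡⟨ cong₂ (λ s t → λ′ * s + t * adj D u w) (indeg≡∑adj D w) (sym (commonOut-diag D u)) ⟩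
    λ′ * ∑[ v < n ] adj D v w + commonOut D u u * adj D u w
      ≡⟨ ∑-weighted-except u (commonOut-liking u) ⟨
    ∑[ v < n ] (commonOut D u v * adj D v w) + λ′ * adj D u w
      ≡⟨ cong (_+ λ′ * adj D u w) (∑commonOut*adj≡∑adj*commonIn D u w) ⟩
    ∑[ x < n ] (adj D u x * commonIn D x w) + λ′ * adj D u w
      ≡⟨ cong (_+ λ′ * adj D u w) (sum-cong-≗ (λ x → *-comm (adj D u x) (commonIn D x w))) ⟩
    ∑[ x < n ] (commonIn D x w * adj D u x) + λ′ * adj D u w
      ≡⟨ ∑-weighted-except w (λ x → commonIn-liking x w) ⟩
    λ′ * ∑[ x < n ] adj D u x + commonIn D w w * adj D u w
      ≡⟨ cong₂ (λ s t → λ′ * s + t * adj D u w) (sym (outdeg≡∑adj D u)) (commonIn-diag D w) ⟩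
    λ′ * outdeg D u + indeg D w * adj D u w
      ∎

  liking⇒indeg≡outdeg : 2 ≤ λ′ → ∀ u w → indeg D w ≡ outdeg D u
  liking⇒indeg≡outdeg 2≤λ′ u w =
    cancel-by-difference (≤-trans (toℕ<2 (arc D u w)) 2≤λ′) (degree-balance u w)

  diregular⇒k*k+λ≡n*λ+k : ∀ {k} → Diregular D k → ∀ u → k * k + λ′ ≡ n * λ′ + k
  diregular⇒k*k+λ≡n*λ+k {k} regular u = begin
    k * k + λ′
      ≡⟨ cong (λ r → r * k + λ′) (trans (sym (proj₁ (regular u))) (outdeg≡∑adj D u)) ⟩
    ∑[ x < n ] adj D u x * k + λ′
      ≡⟨ cong (_+ λ′) (*-distribʳ-sum k (adj D u)) ⟩
    ∑[ x < n ] (adj D u x * k) + λ′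
      ≡⟨ cong (_+ λ′) (sum-cong-≗ (λ x → cong (adj D u x *_) (proj₂ (regular x)))) ⟨
    ∑[ x < n ] (adj D u x * indeg D x) + λ′
      ≡⟨ cong (_+ λ′) (∑commonOut≡∑adj*indeg D u) ⟨
    ∑[ v < n ] commonOut D u v + λ′
      ≡⟨ ∑-except u (commonOut-liking u) ⟩
    ∑[ v < n ] λ′ + commonOut D u u
      ≡⟨ cong₂ _+_ (∑-const n λ′) (trans (commonOut-diag D u) (proj₁ (regular u))) ⟩
    n * λ′ + k
      ∎

theorem1p1 : (n λ′ : ℕ) → 2 ≤ λ′ → 2 ≤ n → (D : Digraph n) →
    TwoWayLiking2 D λ′ →
    Σ ℕ (λ k → (1 ≤ k) × Diregular D k × ((n ∸ 1) * λ′ ≡ k * (k ∸ 1)))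
theorem1p1 (suc n) λ′ 2≤λ′ (s≤s 1≤n) D liking = k , 1≤k , regular , sym k*[k∸1]≡n*λ′
  where
  k : ℕ
  k = outdeg D Fin.zero

  regular : Diregular D k
  regular = equal-degrees⇒diregular D (liking⇒indeg≡outdeg D liking 2≤λ′) Fin.zero

  k*[k∸1]≡n*λ′ : k * (k ∸ 1) ≡ n * λ′
  k*[k∸1]≡n*λ′ = k*k+c≡[1+m]*c+k⇒k*[k∸1]≡m*c k n λ′
                   (diregular⇒k*k+λ≡n*λ+k D liking regular Fin.zero)

  1≤k : 1 ≤ k
  1≤k = 1≤m*n⇒1≤m k (subst (1 ≤_) (sym k*[k∸1]≡n*λ′)
                                    (*-mono-≤ 1≤n (≤-trans (s≤s z≤n) 2≤λ′)))
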